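{- Let $n\ge1$, $0\le m\le n-1$, and let $K$ be a pure $n$-simplicial complex. Then $K$ contains an $(m,n)$-simplicial cycle sequence if and only if there exists a sequence $\eta_1,\dots,\eta_r$ of at least three distinct $n$-simplices of $K$ such that (1) for each $2\le z\le r$, $\eta_{z-1}$ and $\eta_z$ have a common $(n-1)$-face; and (2) there exists an $m$-simplex $\sigma_1$ which is a face of both $\eta_1$ and $\eta_r$ but is not a face of $\eta_t$ for some $2\le t\le r-1$.
   Context: A simplicial complex on a finite vertex set is a collection of non-empty vertex subsets containing all singletons and closed under non-empty subsets; a $k$-simplex has $k+1$ vertices; $\tau$ is a face of $\sigma$ if $\tau\subseteq\sigma$. $K$ is a pure $n$-simplicial complex if $\dim K=n$ and every simplex is a face of some $n$-simplex. An $(m,n)$-walk sequence is an alternating sequence $\sigma_1,\eta_1,\sigma_2,\dots,\sigma_r,\eta_r,\sigma_{r+1}$ of $m$-simplices $\sigma_k$ and $n$-simplices $\eta_k$ with $\sigma_k\ne\sigma_{k+1}$ both faces of $\eta_k$. An $(m,n)$-simplicial cycle sequence is an $(m,n)$-walk sequence with $\sigma_{r+1}=\sigma_1$ and $\sigma_p\ne\sigma_q$, $\eta_p\ne\eta_q$ for $1\le p\ne q\le r$, such that (i) $r\ge 3$; (ii) $\sigma_1$ is not a face of $\eta_k$ for $2\le k\le r-1$; (iii) for each $2\le z\le r$ there is an $(n-1)$-simplex $\sigma'_z$ of $K$ which is a face of both $\eta_{z-1}$ and $\eta_z$ and has $\sigma_z$ as a face, with $\sigma'_x\ne\sigma'_y$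 for $2\le x\ne y\le r$. -}

module Defs where

open import Data.Nat using (ℕ; zero; suc; _+_; _∸_; _≤_; _<_; _≥_)
open import Data.Fin using (Fin)
open import Data.Fin.Subset using (Subset; _⊆_; ⁅_⁆; ∣_∣; Nonempty)
open import Data.Product using (Σ; ∃; _×_; _,_)
open import Relation.Nullary using (¬_)
open import Relation.Binary.PropositionalEquality using (_≡_; _≢_)

record SimplicialComplex (N : ℕ) : Set₁ where
  field
    Simplex     : Subset N → Set
    nonempty    : ∀ s → Simplex s → Nonempty s
    singletons  : ∀ v → Simplex ⁅ v ⁆
    down-closed : ∀ s t → Simplex s → t ⊆ s → Nonempty t → Simplex t
open SimplicialComplex public

module _ {N : ℕ} (K : SimplicialComplex N) where

  IsSimplexOfDim : ℕ → Subset N → Set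
  IsSimplexOfDim k s = Simplex K s × ∣ s ∣ ≡ suc k

  HasDim : ℕ → Set
  HasDim n = (∃ λ s → IsSimplexOfDim n s)
           × (∀ s → Simplex K s → ∣ s ∣ ≤ suc n)

  IsPure : ℕ → Set
  IsPure n = HasDim n
           × (∀ s → Simplex K s → ∃ λ η → IsSimplexOfDim n η × s ⊆ η)

  -- (m,n)-simplicial cycle sequence σ_1,η_1,…,σ_r,η_r,σ_{r+1}
  -- (sequences indexed by ℕ; only indices in the stated ranges matter)
  IsCycleSeq : ℕ → ℕ → ℕ → (ℕ → Subset N) → (ℕ → Subset N) → Set
  IsCycleSeq m n r σ η =
      (∀ k → 1 ≤ k → k ≤ suc r → IsSimplexOfDim m (σ k))
    × (∀ k → 1 ≤ k → k ≤ r → IsSimplexOfDim n (η k))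
    × (∀ k → 1 ≤ k → k ≤ r → σ k ≢ σ (suc k) × σ k ⊆ η k × σ (suc k) ⊆ η k)
    × σ (suc r) ≡ σ 1
    × (∀ p q → 1 ≤ p → p ≤ r → 1 ≤ q → q ≤ r → p ≢ q → σ p ≢ σ q × η p ≢ η q)
    × 3 ≤ r
    × (∀ k → 2 ≤ k → k ≤ r ∸ 1 → ¬ (σ 1 ⊆ η k))
    × (∃ λ (σ' : ℕ → Subset N) →
          (∀ z → 2 ≤ z → z ≤ r →
               IsSimplexOfDim (n ∸ 1) (σ' z)
             × σ' z ⊆ η (z ∸ 1) × σ' z ⊆ η z × σ z ⊆ σ' z)
        × (∀ x y → 2 ≤ x → x ≤ r → 2 ≤ y → y ≤ r → x ≢ y → σ' x ≢ σ' y))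

  HasCycleSeq : ℕ → ℕ → Set
  HasCycleSeq m n = ∃ λ r → ∃ λ σ → ∃ λ η → IsCycleSeq m n r σ η

  HasFaceChain : ℕ → ℕ → Set
  HasFaceChain m n = ∃ λ r → ∃ λ (η : ℕ → Subset N) →
      3 ≤ r
    × (∀ k → 1 ≤ k → k ≤ r → IsSimplexOfDim n (η k))
    × (∀ p q → 1 ≤ p → p ≤ r → 1 ≤ q → q ≤ r → p ≢ q → η p ≢ η q)
    × (∀ z → 2 ≤ z → z ≤ r →
         ∃ λ τ → IsSimplexOfDim (n ∸ 1) τ × τ ⊆ η (z ∸ 1) × τ ⊆ η z)
    × (∃ λ σ₁ → IsSimplexOfDim m σ₁ × σ₁ ⊆ η 1 × σ₁ ⊆ η r
         × ∃ λ t → 2 ≤ t × t ≤ r ∸ 1 × ¬ (σ₁ ⊆ η t))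

{-# OPTIONS --safe #-}
module Submission where

-- A cycle sequence yields such a chain at once: keep its n-simplices and take σ₁ as the common
-- face. Conversely, argue by induction on the length r of a chain η₁ … η_r with such a face s.
-- If s lies in an interior η_k, a window of the chain is shorter. Otherwise choose common
-- (n-1)-faces τ_z of η_{z-1} and η_z. If τ_x = τ_y, or τ_z ⊆ η_{z+1}, the chain can be short-cut,
-- except when the face lies in η₁, η₂ and η_r; then η₁ and η_r both equal that face plus a vertex
-- of s outside η₂, contradicting distinctness. Otherwise pick m-faces ρ_z ⊆ τ_z through a vertex
-- outside η_{z+1}. A repetition ρ_a = ρ_b gives the shorter chain η_a … η_{b-1} with end face ρ_a.
-- Without repetitions, s, ρ₂, …, ρ_r, s interleaved with η₁, …, η_r is a cycle sequence with
-- σ'_z = τ_z.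

open import Defs
open import Data.Bool using () renaming (_≟_ to _≟ᴮ_)
open import Data.Empty using (⊥; ⊥-elim)
open import Data.Fin using (Fin)
open import Data.Fin.Properties using (¬∀⟶∃¬)
open import Data.Fin.Subset using (Subset; inside; outside; _∈_; _∉_; _⊆_; ⁅_⁆; ∣_∣; _∪_)
open import Data.Fin.Subset.Properties
  using ( _∈?_; _⊆?_; ⊆-refl; ⊆-trans; ⊆-antisym; drop-∷-⊆; s⊆s; out⊆; p⊂q⇒∣p∣<∣q∣
        ; p⊆p∪q; q⊆p∪q; x∈p∪q⁻; x∈⁅x⁆; x∈⁅y⁆⇒x≡y; ∣⁅x⁆∣≡1 )
open import Data.Nat using (ℕ; zero; suc; _+_; _∸_; _≤_; _<_; z≤n; s≤s; z<s; _≤?_; _<?_)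
open import Data.Nat.Induction using (<-rec)
open import Data.Nat.Properties
open import Data.Product using (∃; ∃₂; _×_; _,_; proj₁; proj₂)
open import Data.Sum using (_⊎_; inj₁; inj₂; [_,_]′)
open import Data.Vec using ([]; _∷_; here)
open import Data.Vec.Properties using (≡-dec)
open import Function using (id)
open import Function.Bundles using (_⇔_; mk⇔)
open import Relation.Binary using (DecidableEquality; _Preserves_⟶_; tri<; tri≈; tri>)
open import Relation.Binary.PropositionalEquality
open import Relation.Nullary using (¬_; Dec; yes; no; contradiction)
open import Relation.Nullary.Decidable using (_×-dec_; _→-dec_)

InjectiveOn : {A : Set} → ℕ → ℕ → (ℕ → A) → Set
InjectiveOn lo hi f = ∀ a b → lo ≤ a → a ≤ hi → lo ≤ b → b ≤ hi → a ≢ b → f a ≢ f b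

collision-or-injectiveOn : {A : Set} → DecidableEquality A → (f : ℕ → A) → ∀ lo hi →
                           (∃₂ λ a b → lo ≤ a × a < b × b ≤ hi × f a ≡ f b) ⊎ InjectiveOn lo hi f
collision-or-injectiveOn _≟_ f lo hi with anyUpTo? collidesLater? (suc hi)
  where
  collidesLater? : ∀ a → Dec (lo ≤ a × ∃ λ b → b < suc hi × a < b × f a ≡ f b)
  collidesLater? a = (lo ≤? a) ×-dec anyUpTo? (λ b → (a <? b) ×-dec (f a ≟ f b)) (suc hi)
... | yes (a , _ , lo≤a , b , b<1+hi , a<b , fa≡fb) =
  inj₁ (a , b , lo≤a , a<b , m<1+n⇒m≤n b<1+hi , fa≡fb)
... | no none = inj₂ injective
  where
  injective : InjectiveOn lo hi f
  injective a b lo≤a a≤hi lo≤b b≤hi a≢b fa≡fb with <-cmp a b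
  ... | tri< a<b _ _ = none (a , s≤s a≤hi , lo≤a , b , s≤s b≤hi , a<b , fa≡fb)
  ... | tri≈ _ a≡b _ = a≢b a≡b
  ... | tri> _ _ b<a = none (b , s≤s b≤hi , lo≤b , a , s≤s a≤hi , b<a , sym fa≡fb)

chooseOn : {A : Set} (P : ℕ → A → Set) (default : A) → ∀ lo hi →
           (∀ z → lo ≤ z → z ≤ hi → ∃ (P z)) →
           ∃ λ f → (∀ z → lo ≤ z → z ≤ hi → P z (f z))
                 × (∀ z → ¬ (lo ≤ z × z ≤ hi) → f z ≡ default)
chooseOn {A} P default lo hi choice = f , f-inside , f-outside
  where
  pick : ∀ z → Dec (lo ≤ z × z ≤ hi) → A
  pick z (yes (lo≤z , z≤hi)) = proj₁ (choice z lo≤z z≤hi)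
  pick z (no _)              = default

  f : ℕ → A
  f z = pick z ((lo ≤? z) ×-dec (z ≤? hi))

  f-inside : ∀ z → lo ≤ z → z ≤ hi → P z (f z)
  f-inside z lo≤z z≤hi with (lo ≤? z) ×-dec (z ≤? hi)
  ... | yes (lo≤z′ , z≤hi′) = proj₂ (choice z lo≤z′ z≤hi′)
  ... | no out              = contradiction (lo≤z , z≤hi) out

  f-outside : ∀ z → ¬ (lo ≤ z × z ≤ hi) → f z ≡ default
  f-outside z out with (lo ≤? z) ×-dec (z ≤? hi)
  ... | yes inRange = contradiction inRange out
  ... | no _        = refl

m≤n∸1⇒m<n : ∀ {m n} → 1 ≤ n → m ≤ n ∸ 1 → m < n
m≤n∸1⇒m<n {n = suc n} _ m≤n = s≤s m≤n

-- Finite sets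

module _ {N : ℕ} where

  _≟ˢ_ : DecidableEquality (Subset N)
  _≟ˢ_ = ≡-dec _≟ᴮ_

  p⊈q⇒∃∉ : {p q : Subset N} → ¬ (p ⊆ q) → ∃ λ x → x ∈ p × x ∉ q
  p⊈q⇒∃∉ {p} {q} p⊈q
    with ¬∀⟶∃¬ N (λ x → x ∈ p → x ∈ q) (λ x → (x ∈? p) →-dec (x ∈? q))
               (λ p⊆q → p⊈q (p⊆q _))
  ... | x , x∈p⇏x∈q with x ∈? p
  ...   | yes x∈p = x , x∈p , λ x∈q → x∈p⇏x∈q (λ _ → x∈q)
  ...   | no x∉p  = contradiction (λ x∈p → contradiction x∈p x∉p) x∈p⇏x∈q

  p⊆q∧∣q∣≤∣p∣⇒p≡q : {p q : Subset N} → p ⊆ q → ∣ q ∣ ≤ ∣ p ∣ → p ≡ q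
  p⊆q∧∣q∣≤∣p∣⇒p≡q {p} {q} p⊆q ∣q∣≤∣p∣ = ⊆-antisym p⊆q q⊆p
    where
    q⊆p : q ⊆ p
    q⊆p {x} x∈q with x ∈? p
    ... | yes x∈p = x∈p
    ... | no x∉p  = contradiction (p⊂q⇒∣p∣<∣q∣ (p⊆q , x , x∈q , x∉p)) (≤⇒≯ ∣q∣≤∣p∣)

  p∪⁅x⁆≡q : {p q : Subset N} {x : Fin N} →
            p ⊆ q → x ∈ q → x ∉ p → ∣ q ∣ ≡ suc ∣ p ∣ → p ∪ ⁅ x ⁆ ≡ q
  p∪⁅x⁆≡q {p} {q} {x} p⊆q x∈q x∉p ∣q∣≡1+∣p∣ =
    p⊆q∧∣q∣≤∣p∣⇒p≡q p∪⁅x⁆⊆q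
      (subst (_≤ ∣ p ∪ ⁅ x ⁆ ∣) (sym ∣q∣≡1+∣p∣) ∣p∣<∣p∪⁅x⁆∣)
    where
    p∪⁅x⁆⊆q : p ∪ ⁅ x ⁆ ⊆ q
    p∪⁅x⁆⊆q {y} y∈p∪⁅x⁆ with x∈p∪q⁻ p ⁅ x ⁆ y∈p∪⁅x⁆
    ... | inj₁ y∈p   = p⊆q y∈p
    ... | inj₂ y∈⁅x⁆ = subst (_∈ q) (sym (x∈⁅y⁆⇒x≡y x y∈⁅x⁆)) x∈q

    ∣p∣<∣p∪⁅x⁆∣ : ∣ p ∣ < ∣ p ∪ ⁅ x ⁆ ∣
    ∣p∣<∣p∪⁅x⁆∣ = p⊂q⇒∣p∣<∣q∣ (p⊆p∪q ⁅ x ⁆ , x , q⊆p∪q p ⁅ x ⁆ (x∈⁅x⁆ x) , x∉p)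

⊆-between : ∀ {N} {p q : Subset N} k → p ⊆ q → ∣ p ∣ ≤ k → k ≤ ∣ q ∣ →
            ∃ λ r → p ⊆ r × r ⊆ q × ∣ r ∣ ≡ k
⊆-between {p = []} {[]} zero _ _ _ = [] , ⊆-refl , ⊆-refl , refl
⊆-between {p = inside ∷ p} {outside ∷ q} k p⊆q _ _ with p⊆q here
... | ()
⊆-between {p = inside ∷ p} {inside ∷ q} (suc k) p⊆q (s≤s ∣p∣≤k) (s≤s k≤∣q∣)
  with ⊆-between k (drop-∷-⊆ p⊆q) ∣p∣≤k k≤∣q∣
... | r , p⊆r , r⊆q , ∣r∣≡k = inside ∷ r , s⊆s p⊆r , s⊆s r⊆q , cong suc ∣r∣≡k
⊆-between {p = outside ∷ p} {outside ∷ q} k p⊆q ∣p∣≤k k≤∣q∣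
  with ⊆-between k (drop-∷-⊆ p⊆q) ∣p∣≤k k≤∣q∣
... | r , p⊆r , r⊆q , ∣r∣≡k = outside ∷ r , s⊆s p⊆r , s⊆s r⊆q , ∣r∣≡k
⊆-between {p = outside ∷ p} {inside ∷ q} k p⊆q ∣p∣≤k k≤1+∣q∣ with k ≤? ∣ q ∣
... | yes k≤∣q∣ with ⊆-between k (drop-∷-⊆ p⊆q) ∣p∣≤k k≤∣q∣
...   | r , p⊆r , r⊆q , ∣r∣≡k = outside ∷ r , s⊆s p⊆r , out⊆ r⊆q , ∣r∣≡k
⊆-between {p = outside ∷ p} {inside ∷ q} k p⊆q ∣p∣≤k k≤1+∣q∣ | no k≰∣q∣ =
  inside ∷ q , p⊆q , ⊆-refl , ≤-antisym (≰⇒> k≰∣q∣) k≤1+∣q∣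

-- Paths and their subpaths

skip : ℕ → ℕ → ℕ → ℕ
skip a e k with k ≤? a
... | yes _ = k
... | no _  = k + e

skip-≤ : ∀ {a e k} → k ≤ a → skip a e k ≡ k
skip-≤ {a} {e} {k} k≤a with k ≤? a
... | yes _  = refl
... | no k≰a = contradiction k≤a k≰a

skip-> : ∀ {a e k} → a < k → skip a e k ≡ k + e
skip-> {a} {e} {k} a<k with k ≤? a
... | yes k≤a = contradiction k≤a (<⇒≱ a<k)
... | no _    = refl

skip-mono : ∀ a e → skip a e Preserves _<_ ⟶ _<_
skip-mono a e {p} {q} p<q with p ≤? a | q ≤? a
... | yes _  | yes _   = p<q
... | yes _  | no _    = <-≤-trans p<q (m≤m+n q e)
... | no p≰a | yes q≤a = contradiction (≤-trans (<⇒≤ p<q) q≤a) p≰a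
... | no _   | no _    = +-monoˡ-< e p<q

module _ {A : Set} (Node : A → Set) (Adjacent : A → A → Set) where

  record IsPath (r : ℕ) (η : ℕ → A) : Set where
    field
      node     : ∀ k → 1 ≤ k → k ≤ r → Node (η k)
      distinct : InjectiveOn 1 r η
      adjacent : ∀ z → 2 ≤ z → z ≤ r → Adjacent (η (z ∸ 1)) (η z)

  open IsPath

  IsPath-reindex : ∀ {r r′ η} (f : ℕ → ℕ) → IsPath r η →
                   f Preserves _<_ ⟶ _<_ → 1 ≤ f 1 → f r′ ≤ r →
                   (∀ z → 2 ≤ z → z ≤ r′ → Adjacent (η (f (z ∸ 1))) (η (f z))) →
                   IsPath r′ (λ k → η (f k))
  IsPath-reindex {r} {r′} {η} f path f-mono 1≤f1 fr′≤r f-adjacent = record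
    { node     = λ k 1≤k k≤r′ → node path (f k) (lower 1≤k) (upper k≤r′)
    ; distinct = distinct′
    ; adjacent = f-adjacent
    }
    where
    f-mono-≤ : f Preserves _≤_ ⟶ _≤_
    f-mono-≤ p≤q with m≤n⇒m<n∨m≡n p≤q
    ... | inj₁ p<q  = <⇒≤ (f-mono p<q)
    ... | inj₂ refl = ≤-refl

    lower : ∀ {k} → 1 ≤ k → 1 ≤ f k
    lower 1≤k = ≤-trans 1≤f1 (f-mono-≤ 1≤k)

    upper : ∀ {k} → k ≤ r′ → f k ≤ r
    upper k≤r′ = ≤-trans (f-mono-≤ k≤r′) fr′≤r

    distinct′ : InjectiveOn 1 r′ (λ k → η (f k))
    distinct′ p q 1≤p p≤r′ 1≤q q≤r′ p≢q =
      distinct path (f p) (f q) (lower 1≤p) (upper p≤r′) (lower 1≤q) (upper q≤r′) fp≢fq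
      where
      fp≢fq : f p ≢ f q
      fp≢fq with <-cmp p q
      ... | tri< p<q _ _ = <⇒≢ (f-mono p<q)
      ... | tri≈ _ p≡q _ = contradiction p≡q p≢q
      ... | tri> _ _ q<p = ≢-sym (<⇒≢ (f-mono q<p))

  IsPath-window : ∀ {r r′ η} c → IsPath r η → r′ + c ≤ r → IsPath r′ (λ j → η (j + c))
  IsPath-window c path r′+c≤r = IsPath-reindex (_+ c) path (+-monoˡ-< c) (s≤s z≤n) r′+c≤r
    λ { (suc z) 2≤z z≤r′ →
          adjacent path (suc z + c) (≤-trans 2≤z (m≤m+n (suc z) c))
            (≤-trans (+-monoˡ-≤ c z≤r′) r′+c≤r) }

  IsPath-splice : ∀ {r r′ η} a e → IsPath r η → a < r′ → r′ + e ≡ r →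
                  Adjacent (η a) (η (suc a + e)) → IsPath r′ (λ k → η (skip a e k))
  IsPath-splice {r} {r′} {η} a e path a<r′ r′+e≡r ηa~ηb =
    IsPath-reindex (skip a e) path (skip-mono a e) (≤-<-trans z≤n (skip-mono a e z<s))
      (≤-reflexive (trans (skip-> a<r′) r′+e≡r)) adjacent′
    where
    k≤r′⇒k+e≤r : ∀ {k} → k ≤ r′ → k + e ≤ r
    k≤r′⇒k+e≤r k≤r′ = ≤-trans (+-monoˡ-≤ e k≤r′) (≤-reflexive r′+e≡r)

    adjacent′ : ∀ z → 2 ≤ z → z ≤ r′ → Adjacent (η (skip a e (z ∸ 1))) (η (skip a e z))
    adjacent′ (suc z) 2≤z z≤r′ with <-cmp z a
    ... | tri< z<a _ _ rewrite skip-≤ {a} {e} (<⇒≤ z<a) | skip-≤ {a} {e} z<a =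
      adjacent path (suc z) 2≤z (≤-trans (m≤m+n (suc z) e) (k≤r′⇒k+e≤r z≤r′))
    ... | tri≈ _ refl _ rewrite skip-≤ {z} {e} ≤-refl | skip-> {z} {e} (n<1+n z) = ηa~ηb
    ... | tri> _ _ a<z rewrite skip-> {a} {e} a<z | skip-> {a} {e} (m<n⇒m<1+n a<z) =
      adjacent path (suc z + e) (≤-trans 2≤z (m≤m+n (suc z) e)) (k≤r′⇒k+e≤r z≤r′)

-- Simplices

module _ {N : ℕ} (K : SimplicialComplex N) where

  face-through : ∀ {d m τ v} → m ≤ d → IsSimplexOfDim K d τ → v ∈ τ →
                 ∃ λ σ → IsSimplexOfDim K m σ × σ ⊆ τ × v ∈ σ
  face-through {d} {m} {τ} {v} m≤d (τ-simplex , ∣τ∣≡1+d) v∈τ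
    with ⊆-between (suc m) ⁅v⁆⊆τ (subst (_≤ suc m) (sym (∣⁅x⁆∣≡1 v)) (s≤s z≤n))
                               (subst (suc m ≤_) (sym ∣τ∣≡1+d) (s≤s m≤d))
    where
    ⁅v⁆⊆τ : ⁅ v ⁆ ⊆ τ
    ⁅v⁆⊆τ x∈⁅v⁆ = subst (_∈ τ) (sym (x∈⁅y⁆⇒x≡y v x∈⁅v⁆)) v∈τ
  ... | σ , ⁅v⁆⊆σ , σ⊆τ , ∣σ∣≡1+m =
    σ , (down-closed K τ σ τ-simplex σ⊆τ (v , v∈σ) , ∣σ∣≡1+m) , σ⊆τ , v∈σ
    where
    v∈σ : v ∈ σ
    v∈σ = ⁅v⁆⊆σ (x∈⁅x⁆ v)

module _ {N : ℕ} (K : SimplicialComplex N) (n : ℕ) where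

  SharesCodim1Face : Subset N → Subset N → Set
  SharesCodim1Face η η′ = ∃ λ τ → IsSimplexOfDim K (n ∸ 1) τ × τ ⊆ η × τ ⊆ η′

  FacetPath : ℕ → (ℕ → Subset N) → Set
  FacetPath = IsPath (IsSimplexOfDim K n) SharesCodim1Face

  facet-determined : 1 ≤ n → ∀ {τ η η′ v} →
                     IsSimplexOfDim K (n ∸ 1) τ → IsSimplexOfDim K n η → IsSimplexOfDim K n η′ →
                     τ ⊆ η → τ ⊆ η′ → v ∈ η → v ∈ η′ → v ∉ τ → η ≡ η′
  facet-determined (s≤s z≤n) (_ , ∣τ∣≡n) (_ , ∣η∣≡1+n) (_ , ∣η′∣≡1+n)
                   τ⊆η τ⊆η′ v∈η v∈η′ v∉τ =
    trans (sym (p∪⁅x⁆≡q τ⊆η v∈η v∉τ (trans ∣η∣≡1+n (cong suc (sym ∣τ∣≡n)))))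
          (p∪⁅x⁆≡q τ⊆η′ v∈η′ v∉τ (trans ∣η′∣≡1+n (cong suc (sym ∣τ∣≡n))))

-- Shortening a chain

module Shortening {N : ℕ} (K : SimplicialComplex N) (n m : ℕ) (1≤n : 1 ≤ n) (m≤n∸1 : m ≤ n ∸ 1)
  where

  open IsPath

  record EndFace (r : ℕ) (η : ℕ → Subset N) (s : Subset N) : Set where
    field
      dim    : IsSimplexOfDim K m s
      ⊆first : s ⊆ η 1
      ⊆last  : s ⊆ η r
      gap    : ∃ λ t → 1 < t × t < r × ¬ (s ⊆ η t)

    3≤r : 3 ≤ r
    3≤r = let (_ , 1<t , t<r , _) = gap in ≤-trans (s≤s 1<t) t<r

  ChainWithEndFace : ℕ → Set
  ChainWithEndFace r = ∃₂ λ η s → FacetPath K n r η × EndFace r η s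

  Shorter : ℕ → Set
  Shorter r = ∃ λ r′ → r′ < r × ChainWithEndFace r′

  AvoidsInterior : ℕ → (ℕ → Subset N) → Subset N → Set
  AvoidsInterior r η s = ∀ k → 1 < k → k < r → ¬ (s ⊆ η k)

  shorter-by-window : ∀ {r η s a t b} → FacetPath K n r η → IsSimplexOfDim K m s →
                      1 ≤ a → a < t → t < b → b ≤ r → 1 < a ⊎ b < r →
                      s ⊆ η a → s ⊆ η b → ¬ (s ⊆ η t) → Shorter r
  shorter-by-window {r} {η} {s} {suc c} {t} {b} path dim-s _ a<t t<b b≤r inner s⊆ηa s⊆ηb s⊈ηt =
    b ∸ c , r′<r inner , (λ j → η (j + c)) , s ,
    IsPath-window _ _ c path (≤-trans (≤-reflexive b∸c+c≡b) b≤r) ,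
    record
      { dim    = dim-s
      ; ⊆first = s⊆ηa
      ; ⊆last  = subst (λ i → s ⊆ η i) (sym b∸c+c≡b) s⊆ηb
      ; gap    = t ∸ c , m+n≤o⇒m≤o∸n 2 a<t , ∸-monoˡ-< t<b c≤t ,
                 λ s⊆ → s⊈ηt (subst (λ i → s ⊆ η i) (m∸n+n≡m c≤t) s⊆)
      }
    where
    c≤t : c ≤ t
    c≤t = ≤-trans (n≤1+n c) (<⇒≤ a<t)

    c≤b : c ≤ b
    c≤b = ≤-trans c≤t (<⇒≤ t<b)

    b∸c+c≡b : b ∸ c + c ≡ b
    b∸c+c≡b = m∸n+n≡m c≤b

    r′<r : 1 < suc c ⊎ b < r → b ∸ c < r
    r′<r (inj₁ (s≤s 0<c)) = <-≤-trans (∸-monoʳ-< 0<c c≤b) b≤r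
    r′<r (inj₂ b<r)       = ≤-<-trans (m∸n≤m b c) b<r

  shorter-by-interior-face : ∀ {r η s k} → FacetPath K n r η → EndFace r η s →
                             1 < k → k < r → s ⊆ η k → Shorter r
  shorter-by-interior-face {k = k} path endFace 1<k k<r s⊆ηk with EndFace.gap endFace
  ... | t , 1<t , t<r , s⊈ηt with <-cmp k t
  ...   | tri< k<t _ _  =
    shorter-by-window path dim (<⇒≤ 1<k) k<t t<r ≤-refl (inj₁ 1<k) s⊆ηk ⊆last s⊈ηt
    where open EndFace endFace
  ...   | tri≈ _ refl _ = ⊥-elim (s⊈ηt s⊆ηk)
  ...   | tri> _ _ t<k  =
    shorter-by-window path dim ≤-refl 1<t t<k (<⇒≤ k<r) (inj₂ k<r) ⊆first s⊆ηk s⊈ηt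
    where open EndFace endFace

  module Avoiding {r η s} (path : FacetPath K n r η) (dim-s : IsSimplexOfDim K m s)
                  (s⊆first : s ⊆ η 1) (s⊆last : s ⊆ η r) (avoids : AvoidsInterior r η s)
                  (3≤r : 3 ≤ r) where

    1<r : 1 < r
    1<r = ≤-trans (s≤s (s≤s z≤n)) 3≤r

    shorter-by-shortcut : ∀ {a b} → 1 ≤ a → suc a < b → b ≤ r → 1 < a ⊎ b < r →
                          SharesCodim1Face K n (η a) (η b) → Shorter r
    shorter-by-shortcut {a} {b} 1≤a 1+a<b b≤r inner ηa~ηb =
      r ∸ e , ∸-monoʳ-< (m<n⇒0<n∸m 1+a<b) e≤r , (λ k → η (skip a e k)) , s ,
      IsPath-splice _ _ a e path a<r′ r′+e≡r
        (subst (λ i → SharesCodim1Face K n (η a) (η i)) (sym 1+a+e≡b) ηa~ηb) ,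
      record
        { dim    = dim-s
        ; ⊆first = subst (λ i → s ⊆ η i) (sym skip1≡1) s⊆first
        ; ⊆last  = subst (λ i → s ⊆ η i) (sym skipr′≡r) s⊆last
        ; gap    = 2 , ≤-refl , 3≤r′ inner ,
                   avoids (skip a e 2) (subst (_< skip a e 2) skip1≡1 (skip-mono a e ≤-refl))
                                       (subst (skip a e 2 <_) skipr′≡r (skip-mono a e (3≤r′ inner)))
        }
      where
      e : ℕ
      e = b ∸ suc a

      1+a+e≡b : suc a + e ≡ b
      1+a+e≡b = m+[n∸m]≡n (<⇒≤ 1+a<b)

      e≤r : e ≤ r
      e≤r = ≤-trans (m≤n+m e (suc a)) (≤-trans (≤-reflexive 1+a+e≡b) b≤r)

      r′+e≡r : r ∸ e + e ≡ r
      r′+e≡r = m∸n+n≡m e≤r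

      a<r′ : a < r ∸ e
      a<r′ = +-cancelʳ-≤ e (suc a) (r ∸ e) (subst₂ _≤_ (sym 1+a+e≡b) (sym r′+e≡r) b≤r)

      3≤r′ : 1 < a ⊎ b < r → 3 ≤ r ∸ e
      3≤r′ (inj₁ 1<a) = ≤-trans (s≤s 1<a) a<r′
      3≤r′ (inj₂ b<r) = ≤-trans (s≤s (s≤s 1≤a))
        (+-cancelʳ-< e (suc a) (r ∸ e) (subst₂ _<_ (sym 1+a+e≡b) (sym r′+e≡r) b<r))

      skip1≡1 : skip a e 1 ≡ 1
      skip1≡1 = skip-≤ 1≤a

      skipr′≡r : skip a e (r ∸ e) ≡ r
      skipr′≡r = trans (skip-> a<r′) r′+e≡r

    no-face-in-η1-η2-ηr : ∀ {τ} → IsSimplexOfDim K (n ∸ 1) τ →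
                          τ ⊆ η 1 → τ ⊆ η 2 → τ ⊆ η r → ⊥
    no-face-in-η1-η2-ηr dim-τ τ⊆η1 τ⊆η2 τ⊆ηr with p⊈q⇒∃∉ (avoids 2 ≤-refl 3≤r)
    ... | v , v∈s , v∉η2 =
      distinct path 1 r ≤-refl (<⇒≤ 1<r) (<⇒≤ 1<r) ≤-refl (<⇒≢ 1<r)
        (facet-determined K n 1≤n dim-τ (node path 1 ≤-refl (<⇒≤ 1<r)) (node path r (<⇒≤ 1<r) ≤-refl)
           τ⊆η1 τ⊆ηr (s⊆first v∈s) (s⊆last v∈s) (λ v∈τ → v∉η2 (τ⊆η2 v∈τ)))

    shorter-by-shared-face : ∀ {a b τ} → 1 ≤ a → suc a < b → b ≤ r →
                             IsSimplexOfDim K (n ∸ 1) τ → τ ⊆ η a → τ ⊆ η (suc a) → τ ⊆ η b →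
                             Shorter r
    shorter-by-shared-face {a} {b} {τ} 1≤a 1+a<b b≤r dim-τ τ⊆ηa τ⊆η1+a τ⊆ηb with 1 <? a | b <? r
    ... | yes 1<a | _       = shorter-by-shortcut 1≤a 1+a<b b≤r (inj₁ 1<a) (τ , dim-τ , τ⊆ηa , τ⊆ηb)
    ... | no _    | yes b<r = shorter-by-shortcut 1≤a 1+a<b b≤r (inj₂ b<r) (τ , dim-τ , τ⊆ηa , τ⊆ηb)
    ... | no 1≮a  | no b≮r with ≤-antisym (≮⇒≥ 1≮a) 1≤a | ≤-antisym b≤r (≮⇒≥ b≮r)
    ...   | refl | refl = ⊥-elim (no-face-in-η1-η2-ηr dim-τ τ⊆ηa τ⊆η1+a τ⊆ηb)

    SharedFaces : (ℕ → Subset N) → Set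
    SharedFaces τ = ∀ z → 2 ≤ z → z ≤ r →
                    IsSimplexOfDim K (n ∸ 1) (τ z) × τ z ⊆ η (z ∸ 1) × τ z ⊆ η z

    isCycleSeq : ∀ {τ ρ} → SharedFaces τ → InjectiveOn 2 r τ →
                 (∀ z → 2 ≤ z → z ≤ r → IsSimplexOfDim K m (ρ z) × ρ z ⊆ τ z) →
                 (∀ z → ¬ (2 ≤ z × z ≤ r) → ρ z ≡ s) → InjectiveOn 1 r ρ →
                 IsCycleSeq K m n r ρ η
    isCycleSeq {τ} {ρ} faces τ-distinct ρ-faces ρ-outside ρ-distinct =
      ρ-dim , node path , step , trans ρ[1+r]≡s (sym ρ1≡s) ,
      (λ p q 1≤p p≤r 1≤q q≤r p≢q →
         ρ-distinct p q 1≤p p≤r 1≤q q≤r p≢q , distinct path p q 1≤p p≤r 1≤q q≤r p≢q) ,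
      3≤r ,
      (λ k 2≤k k≤r∸1 ρ1⊆ηk →
         avoids k 2≤k (m≤n∸1⇒m<n (<⇒≤ 1<r) k≤r∸1) (subst (_⊆ η k) ρ1≡s ρ1⊆ηk)) ,
      τ ,
      (λ z 2≤z z≤r → let (dim-τ , τ⊆prev , τ⊆this) = faces z 2≤z z≤r in
                     dim-τ , τ⊆prev , τ⊆this , proj₂ (ρ-faces z 2≤z z≤r)) ,
      τ-distinct
      where
      ρ1≡s : ρ 1 ≡ s
      ρ1≡s = ρ-outside 1 (λ { (s≤s () , _) })

      ρ[1+r]≡s : ρ (suc r) ≡ s
      ρ[1+r]≡s = ρ-outside (suc r) (λ (_ , 1+r≤r) → 1+n≰n 1+r≤r)

      ρ-dim : ∀ k → 1 ≤ k → k ≤ suc r → IsSimplexOfDim K m (ρ k)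
      ρ-dim k _ _ with (2 ≤? k) ×-dec (k ≤? r)
      ... | yes (2≤k , k≤r) = proj₁ (ρ-faces k 2≤k k≤r)
      ... | no out          = subst (IsSimplexOfDim K m) (sym (ρ-outside k out)) dim-s

      ρk⊆ηk : ∀ k → 1 ≤ k → k ≤ r → ρ k ⊆ η k
      ρk⊆ηk 1             _   _   = subst (_⊆ η 1) (sym ρ1≡s) s⊆first
      ρk⊆ηk (suc (suc k)) _   k≤r =
        let (_ , ρ⊆τ) = ρ-faces _ (s≤s (s≤s z≤n)) k≤r
            (_ , _ , τ⊆η) = faces _ (s≤s (s≤s z≤n)) k≤r
        in ⊆-trans ρ⊆τ τ⊆η

      step : ∀ k → 1 ≤ k → k ≤ r → ρ k ≢ ρ (suc k) × ρ k ⊆ η k × ρ (suc k) ⊆ η k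
      step k 1≤k k≤r with suc k ≤? r
      ... | yes 1+k≤r =
        let (_ , ρ⊆τ) = ρ-faces (suc k) (s≤s 1≤k) 1+k≤r
            (_ , τ⊆η , _) = faces (suc k) (s≤s 1≤k) 1+k≤r
        in ρ-distinct k (suc k) 1≤k k≤r (s≤s z≤n) 1+k≤r (<⇒≢ ≤-refl) , ρk⊆ηk k 1≤k k≤r ,
           ⊆-trans ρ⊆τ τ⊆η
      ... | no 1+k≰r with ≤-antisym k≤r (≮⇒≥ 1+k≰r)
      ...   | refl =
        (λ ρr≡ρ[1+r] → ρ-distinct r 1 1≤k k≤r ≤-refl (<⇒≤ 1<r) (≢-sym (<⇒≢ 1<r))
                         (trans ρr≡ρ[1+r] (trans ρ[1+r]≡s (sym ρ1≡s)))) ,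
        ρk⊆ηk r 1≤k k≤r , subst (_⊆ η r) (sym ρ[1+r]≡s) s⊆last

    module _ {τ : ℕ → Subset N} (faces : SharedFaces τ) (τ-distinct : InjectiveOn 2 r τ)
             (τ⊈next : ∀ z → 2 ≤ z → z < r → ¬ (τ z ⊆ η (suc z))) where

      leavingVertex : ∀ z → 2 ≤ z → z ≤ r → ∃ λ v → v ∈ τ z × (z < r → v ∉ η (suc z))
      leavingVertex z 2≤z z≤r with z <? r
      ... | yes z<r = let (v , v∈τ , v∉η) = p⊈q⇒∃∉ (τ⊈next z 2≤z z<r) in
                      v , v∈τ , λ _ → v∉η
      ... | no z≮r  = let (v , v∈τ) = nonempty K (τ z) (proj₁ (proj₁ (faces z 2≤z z≤r))) in
                      v , v∈τ , λ z<r → contradiction z<r z≮r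

      LeavingFace : ℕ → Subset N → Set
      LeavingFace z σ = IsSimplexOfDim K m σ × σ ⊆ τ z × (z < r → ¬ (σ ⊆ η (suc z)))

      leavingFace : ∀ z → 2 ≤ z → z ≤ r → ∃ (LeavingFace z)
      leavingFace z 2≤z z≤r with leavingVertex z 2≤z z≤r
      ... | v , v∈τ , v∉η with face-through K m≤n∸1 (proj₁ (faces z 2≤z z≤r)) v∈τ
      ...   | σ , dim-σ , σ⊆τ , v∈σ = σ , dim-σ , σ⊆τ , λ z<r σ⊆η → v∉η z<r (σ⊆η v∈σ)

      module _ {ρ : ℕ → Subset N} (ρ-faces : ∀ z → 2 ≤ z → z ≤ r → LeavingFace z (ρ z)) where

        ρ⊆η : ∀ z → 2 ≤ z → z ≤ r → ρ z ⊆ η z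
        ρ⊆η z 2≤z z≤r =
          let (_ , ρ⊆τ , _) = ρ-faces z 2≤z z≤r
              (_ , _ , τ⊆η) = faces z 2≤z z≤r
          in ⊆-trans ρ⊆τ τ⊆η

        ρ⊆η-prev : ∀ z → 2 ≤ z → z ≤ r → ρ z ⊆ η (z ∸ 1)
        ρ⊆η-prev z 2≤z z≤r =
          let (_ , ρ⊆τ , _) = ρ-faces z 2≤z z≤r
              (_ , τ⊆η , _) = faces z 2≤z z≤r
          in ⊆-trans ρ⊆τ τ⊆η

        ρ⊈η-next : ∀ z → 2 ≤ z → z < r → ¬ (ρ z ⊆ η (suc z))
        ρ⊈η-next z 2≤z z<r = proj₂ (proj₂ (ρ-faces z 2≤z (<⇒≤ z<r))) z<r

        ρ-interior : ∀ z → 2 ≤ z → z ≤ r → ∃ λ k → 1 < k × k < r × ρ z ⊆ η k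
        ρ-interior 1 (s≤s ()) _
        ρ-interior 2 2≤z _ = 2 , ≤-refl , 3≤r , ρ⊆η 2 2≤z (<⇒≤ 3≤r)
        ρ-interior (suc (suc (suc z))) 2≤z z≤r =
          suc (suc z) , s≤s (s≤s z≤n) , z≤r , ρ⊆η-prev (suc (suc (suc z))) 2≤z z≤r

        ρ⊆η-near : ∀ {a b} → 1 < a → a < b → b ≤ suc (suc a) → b ≤ r → ρ b ⊆ η (suc a)
        ρ⊆η-near {a} {b} 1<a a<b b≤2+a b≤r with m≤n⇒m<n∨m≡n b≤2+a
        ... | inj₁ b<2+a with ≤-antisym (≤-pred b<2+a) a<b
        ...   | refl = ρ⊆η (suc a) (≤-trans 1<a (n≤1+n a)) b≤r
        ρ⊆η-near {a} 1<a a<b b≤2+a b≤r | inj₂ refl =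
          ρ⊆η-prev (suc (suc a)) (≤-trans 1<a (m≤n+m a 2)) b≤r

        -- ρ a = ρ b lies in η a and η (b - 1) but not in η (a + 1).
        shorter-by-repeated-face : ∀ {a b} → 1 < a → a < b → b ≤ r → ρ a ≡ ρ b → Shorter r
        shorter-by-repeated-face {a} {suc b} 1<a a<1+b 1+b≤r ρa≡ρ1+b with suc (suc a) <? suc b
        ... | no 2+a≮1+b =
          ⊥-elim (ρ⊈η-next a 1<a a<r
            (subst (_⊆ η (suc a)) (sym ρa≡ρ1+b) (ρ⊆η-near 1<a a<1+b (≮⇒≥ 2+a≮1+b) 1+b≤r)))
          where
          a<r : a < r
          a<r = <-≤-trans a<1+b 1+b≤r
        ... | yes (s≤s 1+a<b) =
          shorter-by-window path (proj₁ (ρ-faces a 1<a (<⇒≤ a<r))) (<⇒≤ 1<a) ≤-refl 1+a<b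
            (≤-trans (n≤1+n b) 1+b≤r) (inj₁ 1<a) (ρ⊆η a 1<a (<⇒≤ a<r))
            (subst (_⊆ η b) (sym ρa≡ρ1+b) (ρ⊆η-prev (suc b) (≤-trans 1<a (<⇒≤ a<1+b)) 1+b≤r))
            (ρ⊈η-next a 1<a a<r)
          where
          a<r : a < r
          a<r = <-≤-trans a<1+b 1+b≤r

      shorter-or-cycleSeq-with-faces : Shorter r ⊎ HasCycleSeq K m n
      shorter-or-cycleSeq-with-faces with chooseOn LeavingFace s 2 r leavingFace
      ... | ρ , ρ-faces , ρ-outside with collision-or-injectiveOn _≟ˢ_ ρ 1 r
      ...   | inj₂ ρ-distinct =
        inj₂ (r , ρ , η , isCycleSeq faces τ-distinct
                            (λ z 2≤z z≤r → let (dim-ρ , ρ⊆τ , _) = ρ-faces z 2≤z z≤r in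
                                           dim-ρ , ρ⊆τ)
                            ρ-outside ρ-distinct)
      ...   | inj₁ (suc (suc a) , b , _ , a<b , b≤r , ρa≡ρb) =
        inj₁ (shorter-by-repeated-face ρ-faces (s≤s (s≤s z≤n)) a<b b≤r ρa≡ρb)
      ...   | inj₁ (1 , b , _ , 1<b , b≤r , ρ1≡ρb) with ρ-interior ρ-faces b 1<b b≤r
      ...     | k , 1<k , k<r , ρb⊆ηk =
        ⊥-elim (avoids k 1<k k<r (subst (_⊆ η k) ρb≡s ρb⊆ηk))
        where
        ρb≡s : ρ b ≡ s
        ρb≡s = trans (sym ρ1≡ρb) (ρ-outside 1 (λ { (s≤s () , _) }))

    shorter-or-cycleSeq-avoiding : Shorter r ⊎ HasCycleSeq K m n
    shorter-or-cycleSeq-avoiding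
      with chooseOn (λ z τ → IsSimplexOfDim K (n ∸ 1) τ × τ ⊆ η (z ∸ 1) × τ ⊆ η z) s 2 r
                    (adjacent path)
    ... | τ , faces , _ with collision-or-injectiveOn _≟ˢ_ τ 2 r
    ...   | inj₁ (suc a , b , 2≤1+a , 1+a<b , b≤r , τ1+a≡τb) =
      let (dim-τ , τ⊆ηa , τ⊆η1+a) = faces (suc a) 2≤1+a (≤-trans (<⇒≤ 1+a<b) b≤r)
          τb⊆ηb = proj₂ (proj₂ (faces b (≤-trans 2≤1+a (<⇒≤ 1+a<b)) b≤r))
      in inj₁ (shorter-by-shared-face (≤-pred 2≤1+a) 1+a<b b≤r dim-τ τ⊆ηa τ⊆η1+a
                 (subst (_⊆ η b) (sym τ1+a≡τb) τb⊆ηb))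
    ...   | inj₂ τ-distinct with anyUpTo? (λ z → (2 ≤? z) ×-dec (τ z ⊆? η (suc z))) r
    ...     | yes (suc a , 1+a<r , 2≤1+a , τ1+a⊆η2+a) =
      let (dim-τ , τ⊆ηa , τ⊆η1+a) = faces (suc a) 2≤1+a (<⇒≤ 1+a<r)
      in inj₁ (shorter-by-shared-face (≤-pred 2≤1+a) ≤-refl 1+a<r dim-τ τ⊆ηa τ⊆η1+a τ1+a⊆η2+a)
    ...     | no none =
      shorter-or-cycleSeq-with-faces faces τ-distinct
        (λ z 2≤z z<r τz⊆η1+z → none (z , z<r , 2≤z , τz⊆η1+z))

  shorter-or-cycleSeq : ∀ {r η s} → FacetPath K n r η → EndFace r η s → Shorter r ⊎ HasCycleSeq K m n
  shorter-or-cycleSeq {r} {η} {s} path endFace with anyUpTo? (λ k → (1 <? k) ×-dec (s ⊆? η k)) r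
  ... | yes (k , k<r , 1<k , s⊆ηk) = inj₁ (shorter-by-interior-face path endFace 1<k k<r s⊆ηk)
  ... | no none =
    Avoiding.shorter-or-cycleSeq-avoiding path dim ⊆first ⊆last
      (λ k 1<k k<r s⊆ηk → none (k , k<r , 1<k , s⊆ηk)) 3≤r
    where open EndFace endFace

  cycleSeq-from-chain : ∀ r → ChainWithEndFace r → HasCycleSeq K m n
  cycleSeq-from-chain = <-rec _ λ r shorter (_ , _ , path , endFace) →
    [ (λ (_ , r′<r , chain) → shorter r′<r chain) , id ]′ (shorter-or-cycleSeq path endFace)

module _ {N : ℕ} (K : SimplicialComplex N) {n m : ℕ} where

  cycleSeq⇒faceChain : HasCycleSeq K m n → HasFaceChain K m n
  cycleSeq⇒faceChain
    (r , σ , η , σ-dim , η-dim , steps , closed , distinct , 3≤r , avoids , τ , faces , _) =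
    r , η , 3≤r , η-dim ,
    (λ p q 1≤p p≤r 1≤q q≤r p≢q → proj₂ (distinct p q 1≤p p≤r 1≤q q≤r p≢q)) ,
    (λ z 2≤z z≤r → let (dim-τ , τ⊆prev , τ⊆this , _) = faces z 2≤z z≤r in
                   τ z , dim-τ , τ⊆prev , τ⊆this) ,
    σ 1 , σ-dim 1 ≤-refl (s≤s z≤n) , proj₁ (proj₂ (steps 1 ≤-refl 1≤r)) ,
    subst (_⊆ η r) closed (proj₂ (proj₂ (steps r 1≤r ≤-refl))) ,
    2 , ≤-refl , 2≤r∸1 , avoids 2 ≤-refl 2≤r∸1
    where
    1≤r : 1 ≤ r
    1≤r = ≤-trans (s≤s z≤n) 3≤r

    2≤r∸1 : 2 ≤ r ∸ 1
    2≤r∸1 = m+n≤o⇒m≤o∸n 2 3≤r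

  faceChain⇒cycleSeq : 1 ≤ n → m ≤ n ∸ 1 → HasFaceChain K m n → HasCycleSeq K m n
  faceChain⇒cycleSeq 1≤n m≤n∸1
    (r , η , 3≤r , η-dim , distinct , adjacent , s , dim , ⊆first , ⊆last , t , 1<t , t≤r∸1 , s⊈ηt) =
    cycleSeq-from-chain r (η , s , path , endFace)
    where
    open Shortening K n m 1≤n m≤n∸1

    path : FacetPath K n r η
    path = record { node = η-dim ; distinct = distinct ; adjacent = adjacent }

    endFace : EndFace r η s
    endFace = record
      { dim    = dim
      ; ⊆first = ⊆first
      ; ⊆last  = ⊆last
      ; gap    = t , 1<t , m≤n∸1⇒m<n (≤-trans (s≤s z≤n) 3≤r) t≤r∸1 , s⊈ηt
      }

theorem4p1 : (N : ℕ) (K : SimplicialComplex N) (n m : ℕ) →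
    1 ≤ n → m ≤ n ∸ 1 → IsPure K n →
    (HasCycleSeq K m n ⇔ HasFaceChain K m n)
theorem4p1 N K n m 1≤n m≤n∸1 _ = mk⇔ (cycleSeq⇒faceChain K) (faceChain⇒cycleSeq K 1≤n m≤n∸1)
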